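{- Let $(A,\le,0,1)$ be a bounded MLUB-complete poset, $(T,R)$ a time frame with $R$ reflexive, and $P,F,H,G$ the tense operators induced by $(T,R)$. Then for every $B\in\mathcal P_+(A^T)$: $P(B)\le_2(P*F)(B)$, $F(B)\le_2(F*P)(B)$, $H(B)\le_1(H*P)(B)$, $G(B)\le_1(G*P)(B)$, $(P*H)(B)\le_2P(B)$, $(F*H)(B)\le_2F(B)$, $H(B)\le_1(H*F)(B)$, $G(B)\le_1(G*F)(B)$, $(P*G)(B)\le_2P(B)$, $(F*G)(B)\le_2F(B)$, $(H*G)(B)\le_1H(B)$, $(G*H)(B)\le_1G(B)$.
   Context: For a poset and $X\subseteq A$: $L(X)$, $U(X)$ the sets of lower/upper bounds, $\operatorname{Max}X,\operatorname{Min}X$ the maximal/minimal elements. MLUB-complete: for every nonempty $M$, every upper bound of $M$ lies above a minimal upper bound and every lower bound below a maximal lower bound. $\mathcal P_+(X)$ = nonempty subsets. For subsets $X,Y$: $X\le_1Y$ iff every $x\in X$ lies below some $y\in Y$; $X\le_2Y$ iff every $y\in Y$ lies above some $x\in X$. $A^T$ is ordered componentwise; each $Z\in(\mathcal P_+A)^T$ is identified with $\varphi(Z)=\{q\in A^T\mid q(t)\in Z(t)\ \forall t\}\subseteq A^T$ for comparisons. A time frame is $(T,R)$, $T\ne\emptyset$, $R\subseteq T^2$. The induced tense operators $P,F,H,G:\mathcal P_+(A^T)\to(\mathcal P_+A)^T$ are $P(B)(s)=\operatorname{Min}U(\{q(t)\mid q\in B,tRs\})$, $F(B)(s)=\operatorname{Min}U(\{q(t)\mid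 q\in B,sRt\})$, $H(B)(s)=\operatorname{Max}L(\{q(t)\mid q\in B,tRs\})$, $G(B)(s)=\operatorname{Max}L(\{q(t)\mid q\in B,sRt\})$. For $X,Y$ among these, $X*Y=X\circ\varphi\circ Y$. -}

module Defs where

open import Level using (Level; _⊔_)
open import Data.Product using (Σ; ∃; _×_; _,_)
open import Relation.Binary using (Rel; Reflexive)
open import Relation.Binary.Bundles using (Poset)
open import Relation.Binary.PropositionalEquality using (_≡_)
open import Relation.Unary using (Pred; _∈_)

module PosetNotions {a : Level} (𝒫 : Poset a a a) where
  open Poset 𝒫 renaming (Carrier to A)

  L : Pred A a → Pred A a
  L X y = ∀ x → x ∈ X → y ≤ x

  U : Pred A a → Pred A a
  U X y = ∀ x → x ∈ X → x ≤ y

  Max : Pred A a → Pred A a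
  Max X x = x ∈ X × (∀ y → y ∈ X → x ≤ y → x ≈ y)

  Min : Pred A a → Pred A a
  Min X x = x ∈ X × (∀ y → y ∈ X → y ≤ x → x ≈ y)

  Nonempty : Pred A a → Set a
  Nonempty X = ∃ λ x → x ∈ X

  Bounded : Set a
  Bounded = (∃ λ o → ∀ x → o ≤ x) × (∃ λ i → ∀ x → x ≤ i)

  MLUBComplete : Set (Level.suc a)
  MLUBComplete =
    ∀ (M : Pred A a) → Nonempty M →
      (∀ u → u ∈ U M → ∃ λ w → w ∈ Min (U M) × w ≤ u)
    × (∀ l → l ∈ L M → ∃ λ w → w ∈ Max (L M) × l ≤ w)

module TenseOps {a : Level} (𝒫 : Poset a a a) {T : Set a} (R : Rel T a) where
  open Poset 𝒫 renaming (Carrier to A)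
  open PosetNotions 𝒫 public

  _≤ᵀ_ : (T → A) → (T → A) → Set a
  p ≤ᵀ q = ∀ t → p t ≤ q t

  _≤₁_ : Pred (T → A) a → Pred (T → A) a → Set a
  X ≤₁ Y = ∀ x → x ∈ X → ∃ λ y → y ∈ Y × x ≤ᵀ y

  _≤₂_ : Pred (T → A) a → Pred (T → A) a → Set a
  X ≤₂ Y = ∀ y → y ∈ Y → ∃ λ x → x ∈ X × x ≤ᵀ y

  φ : (T → Pred A a) → Pred (T → A) a
  φ Z q = ∀ t → q t ∈ Z t

  past : Pred (T → A) a → T → Pred A a
  past B s x = ∃ λ q → ∃ λ t → q ∈ B × R t s × x ≡ q t

  future : Pred (T → A) a → T → Pred A a
  future B s x = ∃ λ q → ∃ λ t → q ∈ B × R s t × x ≡ q t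

  P F H G : Pred (T → A) a → T → Pred A a
  P B s = Min (U (past B s))
  F B s = Min (U (future B s))
  H B s = Max (L (past B s))
  G B s = Max (L (future B s))

  _*_ : (Pred (T → A) a → T → Pred A a) → (Pred (T → A) a → T → Pred A a)
      → Pred (T → A) a → T → Pred A a
  (X * Y) B = X (φ (Y B))

{-# OPTIONS --safe #-}
module Submission where

open import Defs
open import Level using (Level)
open import Data.Product using (Σ; ∃; _×_; _,_; proj₁; proj₂)
open import Function using (flip)
open import Relation.Binary using (Rel; Reflexive)
open import Relation.Binary.Bundles using (Poset)
open import Relation.Binary.PropositionalEquality using (refl)
open import Relation.Unary using (Pred; _∈_; _⊆_)

-- P turns B ≤₁ C into φ (P B) ≤₂ φ (P C), and H turns B ≤₂ C into
-- φ (H B) ≤₁ φ (H C), so each inequality is the outer operator applied to a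
-- comparison between B and φ (P′ B) or φ (H′ B) for the inner operator.  By
-- reflexivity every q ∈ B occurs in its own past, so members of φ (P B) lie
-- above all of B and members of φ (H B) below all of B; boundedness and
-- MLUB-completeness make φ (P B) and φ (H B) nonempty.  F and G are P and H of
-- the converse relation.

∀∃⇒∃∀ : ∀ {a b c} {S : Set a} {W : Set b} {Q : S → W → Set c}
      → (∀ s → ∃ (Q s)) → Σ (S → W) λ f → ∀ s → Q s (f s)
∀∃⇒∃∀ h = (λ s → proj₁ (h s)) , (λ s → proj₂ (h s))

module Frame {a : Level} (𝒫 : Poset a a a) {T : Set a} (R : Rel T a) where
  open Poset 𝒫 renaming (Carrier to A) using (_≤_; trans)
  open TenseOps 𝒫 R

  U-past-antitone : ∀ {B C s} → B ≤₁ C → U (past C s) ⊆ U (past B s)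
  U-past-antitone B≤₁C u∈U _ (q , t , q∈B , tRs , refl) =
    let z , z∈C , q≤z = B≤₁C q q∈B in
    trans (q≤z t) (u∈U (z t) (z , t , z∈C , tRs , refl))

  L-past-monotone : ∀ {B C s} → B ≤₂ C → L (past B s) ⊆ L (past C s)
  L-past-monotone B≤₂C l∈L _ (z , t , z∈C , tRs , refl) =
    let q , q∈B , q≤z = B≤₂C z z∈C in
    trans (l∈L (q t) (q , t , q∈B , tRs , refl)) (q≤z t)

  module _ (mlub : MLUBComplete) where

    φ-Min-U-≤₂ : (M : T → Pred A a) → (∀ s → Nonempty (M s)) → {Y : Pred (T → A) a}
               → (∀ y → y ∈ Y → ∀ s → y s ∈ U (M s)) → φ (λ s → Min (U (M s))) ≤₂ Y
    φ-Min-U-≤₂ M M-ne Y⊆U y y∈Y =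
      let w , minimal-below = ∀∃⇒∃∀ λ s → proj₁ (mlub (M s) (M-ne s)) (y s) (Y⊆U y y∈Y s) in
      w , (λ s → proj₁ (minimal-below s)) , (λ s → proj₂ (minimal-below s))

    ≤₁-φ-Max-L : (M : T → Pred A a) → (∀ s → Nonempty (M s)) → {X : Pred (T → A) a}
               → (∀ x → x ∈ X → ∀ s → x s ∈ L (M s)) → X ≤₁ φ (λ s → Max (L (M s)))
    ≤₁-φ-Max-L M M-ne X⊆L x x∈X =
      let w , maximal-above = ∀∃⇒∃∀ λ s → proj₂ (mlub (M s) (M-ne s)) (x s) (X⊆L x x∈X s) in
      w , (λ s → proj₁ (maximal-above s)) , (λ s → proj₂ (maximal-above s))

  module _ (R-refl : Reflexive R) where

    ∈-past : ∀ {B q} s → q ∈ B → q s ∈ past B s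
    ∈-past {q = q} s q∈B = q , s , q∈B , R-refl , refl

    past-nonempty : ∀ {B} → ∃ B → ∀ s → Nonempty (past B s)
    past-nonempty (q , q∈B) s = q s , ∈-past s q∈B

    φP-upper : ∀ {B q z} → z ∈ φ (P B) → q ∈ B → q ≤ᵀ z
    φP-upper z∈P q∈B t = proj₁ (z∈P t) _ (∈-past t q∈B)

    φH-lower : ∀ {B q z} → z ∈ φ (H B) → q ∈ B → z ≤ᵀ q
    φH-lower z∈H q∈B t = proj₁ (z∈H t) _ (∈-past t q∈B)

    ≤₂-φP : ∀ {B} → ∃ B → B ≤₂ φ (P B)
    ≤₂-φP (q , q∈B) z z∈P = q , q∈B , φP-upper z∈P q∈B

    φH-≤₁ : ∀ {B} → ∃ B → φ (H B) ≤₁ B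
    φH-≤₁ (q , q∈B) z z∈H = q , q∈B , φH-lower z∈H q∈B

    module _ (mlub : MLUBComplete) where

      φP-mono : ∀ {B C} → ∃ B → B ≤₁ C → φ (P B) ≤₂ φ (P C)
      φP-mono {B} B-ne B≤₁C = φ-Min-U-≤₂ mlub (past B) (past-nonempty B-ne)
        λ y y∈PC s → U-past-antitone B≤₁C (proj₁ (y∈PC s))

      φH-mono : ∀ {B C} → ∃ C → B ≤₂ C → φ (H B) ≤₁ φ (H C)
      φH-mono {C = C} C-ne B≤₂C = ≤₁-φ-Max-L mlub (past C) (past-nonempty C-ne)
        λ x x∈HB s → L-past-monotone B≤₂C (proj₁ (x∈HB s))

      module _ (bounded : Bounded) where

        φP-nonempty : ∀ {B} → ∃ B → ∃ (φ (P B))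
        φP-nonempty {B} B-ne = ∀∃⇒∃∀ {Q = λ s w → w ∈ P B s} λ s →
          let ⊤ , x≤⊤ = proj₂ bounded
              w , w∈Min , _ = proj₁ (mlub (past B s) (past-nonempty B-ne s)) ⊤ (λ x _ → x≤⊤ x)
          in w , w∈Min

        φH-nonempty : ∀ {B} → ∃ B → ∃ (φ (H B))
        φH-nonempty {B} B-ne = ∀∃⇒∃∀ {Q = λ s w → w ∈ H B s} λ s →
          let ⊥ , ⊥≤x = proj₁ bounded
              w , w∈Max , _ = proj₂ (mlub (past B s) (past-nonempty B-ne s)) ⊥ (λ x _ → ⊥≤x x)
          in w , w∈Max

        ≤₁-φP : ∀ {B} → ∃ B → B ≤₁ φ (P B)
        ≤₁-φP B-ne q q∈B = let z , z∈P = φP-nonempty B-ne in z , z∈P , φP-upper z∈P q∈B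

        φH-≤₂ : ∀ {B} → ∃ B → φ (H B) ≤₂ B
        φH-≤₂ B-ne q q∈B = let z , z∈H = φH-nonempty B-ne in z , z∈H , φH-lower z∈H q∈B

module Composite {a : Level} (𝒫 : Poset a a a)
                 (bounded : PosetNotions.Bounded 𝒫) (mlub : PosetNotions.MLUBComplete 𝒫)
                 {T : Set a} (R R′ : Rel T a) (R-refl : Reflexive R) (R′-refl : Reflexive R′) where
  open TenseOps 𝒫 R using (P; H; φ; _≤₁_; _≤₂_; _*_)
  open TenseOps 𝒫 R′ using () renaming (P to P′; H to H′)
  private
    module Outer = Frame 𝒫 R
    module Inner = Frame 𝒫 R′

  P-≤₂-P*P′ : ∀ {B} → ∃ B → φ (P B) ≤₂ φ ((P * P′) B)
  P-≤₂-P*P′ B-ne = Outer.φP-mono R-refl mlub B-ne (Inner.≤₁-φP R′-refl mlub bounded B-ne)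

  H-≤₁-H*P′ : ∀ {B} → ∃ B → φ (H B) ≤₁ φ ((H * P′) B)
  H-≤₁-H*P′ B-ne =
    Outer.φH-mono R-refl mlub (Inner.φP-nonempty R′-refl mlub bounded B-ne) (Inner.≤₂-φP R′-refl B-ne)

  P*H′-≤₂-P : ∀ {B} → ∃ B → φ ((P * H′) B) ≤₂ φ (P B)
  P*H′-≤₂-P B-ne =
    Outer.φP-mono R-refl mlub (Inner.φH-nonempty R′-refl mlub bounded B-ne) (Inner.φH-≤₁ R′-refl B-ne)

  H*H′-≤₁-H : ∀ {B} → ∃ B → φ ((H * H′) B) ≤₁ φ (H B)
  H*H′-≤₁-H B-ne = Outer.φH-mono R-refl mlub B-ne (Inner.φH-≤₂ R′-refl mlub bounded B-ne)

theorem3p12 : {a : Level} (𝒫 : Poset a a a) → PosetNotions.Bounded 𝒫 → PosetNotions.MLUBComplete 𝒫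
    → (T : Set a) (R : Rel T a) → Reflexive R
    → let open TenseOps 𝒫 R in
    (B : Pred (T → Poset.Carrier 𝒫) a) → (∃ λ q → B q)
    → (φ (P B) ≤₂ φ ((P * F) B)) × (φ (F B) ≤₂ φ ((F * P) B))
    × (φ (H B) ≤₁ φ ((H * P) B)) × (φ (G B) ≤₁ φ ((G * P) B))
    × (φ ((P * H) B) ≤₂ φ (P B)) × (φ ((F * H) B) ≤₂ φ (F B))
    × (φ (H B) ≤₁ φ ((H * F) B)) × (φ (G B) ≤₁ φ ((G * F) B))
    × (φ ((P * G) B) ≤₂ φ (P B)) × (φ ((F * G) B) ≤₂ φ (F B))
    × (φ ((H * G) B) ≤₁ φ (H B)) × (φ ((G * H) B) ≤₁ φ (G B))
theorem3p12 𝒫 bounded mlub T R R-refl B B-ne =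
    PF.P-≤₂-P*P′ B-ne
  , FP.P-≤₂-P*P′ B-ne
  , PP.H-≤₁-H*P′ B-ne
  , FP.H-≤₁-H*P′ B-ne
  , PP.P*H′-≤₂-P B-ne
  , FP.P*H′-≤₂-P B-ne
  , PF.H-≤₁-H*P′ B-ne
  , FF.H-≤₁-H*P′ B-ne
  , PF.P*H′-≤₂-P B-ne
  , FF.P*H′-≤₂-P B-ne
  , PF.H*H′-≤₁-H B-ne
  , FP.H*H′-≤₁-H B-ne
  where
  module PP = Composite 𝒫 bounded mlub R R R-refl R-refl
  module PF = Composite 𝒫 bounded mlub R (flip R) R-refl R-refl
  module FP = Composite 𝒫 bounded mlub (flip R) R R-refl R-refl
  module FF = Composite 𝒫 bounded mlub (flip R) (flip R) R-refl R-refl
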